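{- Let $f(n,k)$ denote the number of intervals of rank $k$ in the middle order $\mathcal{P}_n$ ($n\ge1$, $k\ge0$). Then $f(1,0)=1$, and for $n\ge 2$ and $k\in[0,\binom{n}{2}]$, $$f(n,k)=\sum_{h=0}^{n-1}(n-h)\, f(n-1,k-h),$$ with the convention $f(n,j)=0$ for $j<0$.
   Context: For $w\in S_n$ (one-line notation), its inversion sequence is $I(w)=(x_1,\ldots,x_n)$ with $x_i=\#\{j<i : w^{ -1}(j)>w^{ -1}(i)\}$. The middle order $\mathcal{P}_n$ is the poset on $S_n$ with $v\le w$ iff $I(v)\le I(w)$ coordinate-wise. It is graded with rank function $r(w)$ equal to the number of inversions of $w$ (the sum of the entries of $I(w)$); the rank of an interval $[v,w]$ is $r(w)-r(v)$. -}

module Defs where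

open import Data.Nat using (ℕ; zero; suc; _+_; _≤ᵇ_; _<ᵇ_; _≡ᵇ_)
open import Data.Bool using (Bool; _∧_; if_then_else_)
open import Data.Bool.ListAction using (and)
open import Data.Fin using (Fin; toℕ)
open import Data.Fin.Properties using (_≟_)
open import Data.List using (List; []; _∷_; map; concatMap; filter; filterᵇ; length; allFin; zipWith)
open import Data.Nat.ListAction using (sum)
open import Data.Vec using (Vec; []; _∷_; toList; tabulate)
open import Data.Product using (_×_; _,_)
open import Data.Integer using (ℤ; +_; -[1+_])
open import Relation.Nullary.Decidable using (⌊_⌋)
import Data.List.Relation.Unary.Unique.DecPropositional as UDec

allVecs : {A : Set} → List A → (m : ℕ) → List (Vec A m)
allVecs xs zero    = [] ∷ []
allVecs xs (suc m) = concatMap (λ x → map (x ∷_) (allVecs xs m)) xs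

-- S_n: all permutations in one-line notation w = (w(1),...,w(n)), with
-- values in Fin n = {0,...,n-1} (shift by one from the paper):
-- the words of length n over Fin n with pairwise distinct entries.
Sym : (n : ℕ) → List (Vec (Fin n) n)
Sym n = filter (λ w → UDec.unique? (_≟_ {n}) (toList w)) (allVecs (allFin n) n)

-- position (0-based) of the first occurrence of a in a list; for a
-- permutation w this is w^{-1}(a) (shifted by one).
posOf : {n : ℕ} → Fin n → List (Fin n) → ℕ
posOf a []       = zero
posOf a (b ∷ bs) = if ⌊ a ≟ b ⌋ then zero else suc (posOf a bs)

winv : {n : ℕ} → Vec (Fin n) n → Fin n → ℕ
winv w a = posOf a (toList w)

invSeq : {n : ℕ} → Vec (Fin n) n → Vec ℕ n
invSeq {n} w = tabulate λ i →
  length (filterᵇ (λ j → (toℕ j <ᵇ toℕ i) ∧ (winv w i <ᵇ winv w j)) (allFin n))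

rank : {n : ℕ} → Vec (Fin n) n → ℕ
rank w = sum (toList (invSeq w))

_≤ᵛ_ : {n : ℕ} → Vec ℕ n → Vec ℕ n → Bool
xs ≤ᵛ ys = and (zipWith _≤ᵇ_ (toList xs) (toList ys))

_≤ₘ_ : {n : ℕ} → Vec (Fin n) n → Vec (Fin n) n → Bool
v ≤ₘ w = invSeq v ≤ᵛ invSeq w

isIntervalOfRank : {n : ℕ} → ℕ → Vec (Fin n) n × Vec (Fin n) n → Bool
isIntervalOfRank k (v , w) = (v ≤ₘ w) ∧ (rank w ≡ᵇ rank v + k)

-- f(n,k) = number of intervals of rank k in P_n
-- (intervals [v,w] are counted as pairs (v,w) of S_n × S_n).
f : ℕ → ℕ → ℕ
f n k = length (filterᵇ (isIntervalOfRank k)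
                        (concatMap (λ v → map (v ,_) (Sym n)) (Sym n)))

fℤ : ℕ → ℤ → ℕ
fℤ n (+ k)      = f n k
fℤ n -[1+ _ ]   = 0

module Submission where

-- The inversion sequence is a bijection from S_n onto the Lehmer codes, the vectors c with c_i ≤ i.
-- Its inverse inserts the values 0, 1, …, n−1 one after the other into a growing word, placing i
-- so that exactly c_i of the smaller values follow it.  Hence f(n,k) counts pairs of codes c ≤ d
-- (coordinatewise) whose entries sum to Σc + k = Σd.  Splitting off the last coordinates a ≤ b of
-- such a pair leaves a pair of codes of length n−1 with rank difference k − (b − a), and among the
-- pairs 0 ≤ a ≤ b ≤ n−1 exactly n − h have b − a = h.

open import Defs
open import Algebra.Properties.CommutativeSemigroup using (interchange)
open import Data.Bool using (Bool; true; false; T; _∧_; if_then_else_)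
open import Data.Bool.Properties using (∧-identityʳ; ∧-zeroʳ; ∧-assoc)
open import Data.Fin using (Fin; zero; suc; toℕ; inject₁; fromℕ)
open import Data.Fin.Properties using (toℕ-inject₁; toℕ-fromℕ; toℕ<n; toℕ-injective) renaming (_≟_ to _≟ᶠ_)
open import Data.Integer as ℤ using (ℤ; -[1+_])
open import Data.Integer.Properties using (m-n≡m⊖n; ⊖-≥; ⊖-<)
open import Data.List using (List; []; _∷_; _++_; [_]; length; map; filterᵇ; concatMap; cartesianProductWith; upTo; allFin; take; drop)
open import Data.List.Properties using (map-++; upTo-∷ʳ; map-upTo; length-++; length-drop; take++drop≡id; filter-++; filter-all; map-tabulate; length-tabulate; map-∘; map-id-local; ∷-injective)
open import Data.List.Membership.Propositional using (_∈_; _∉_)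
open import Data.List.Membership.Propositional.Properties using (∈-allFin; ∈-map⁺; ∈-map⁻; ∈-filter⁺; ∈-filter⁻; ∈-∃++; ∈-++⁺ˡ; ∈-++⁺ʳ; ∈-upTo⁺; ∈-upTo⁻; ∈-cartesianProductWith⁺; ∈-cartesianProductWith⁻)
open import Data.List.Membership.Propositional.Properties.WithK using (unique∧set⇒bag)
open import Data.List.Relation.Binary.BagAndSetEquality using (∼bag⇒↭)
open import Data.List.Relation.Binary.Permutation.Propositional using (_↭_; ↭-refl; ↭-sym; ↭-trans; ↭-prep; ↭-swap; ↭⇒↭ₛ)
import Data.List.Relation.Binary.Permutation.Propositional.Properties as ↭
import Data.List.Relation.Binary.Permutation.Setoid.Properties as ↭ₛ
open import Data.List.Relation.Binary.Subset.Propositional using (_⊆_)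
open import Data.List.Relation.Unary.All as All using (All; []; _∷_)
import Data.List.Relation.Unary.All.Properties as All
open import Data.List.Relation.Unary.Any using (here; there)
open import Data.List.Relation.Unary.Unique.Propositional using (Unique; []; _∷_)
import Data.List.Relation.Unary.Unique.Propositional.Properties as Unique
import Data.List.Relation.Unary.Unique.DecPropositional as UniqueDec
open import Data.Nat using (ℕ; zero; suc; _+_; _*_; _∸_; _⊓_; _≤_; _<_; z≤n; s≤s; s≤s⁻¹; _≤ᵇ_; _<ᵇ_; _≡ᵇ_)
open import Data.Nat.Combinatorics using (_C_)
open import Data.Nat.ListAction using (sum)
open import Data.Nat.ListAction.Properties using (sum-++; sum-↭)
open import Data.Nat.Properties
open import Data.Nat.Tactic.RingSolver using (solve-∀)
open import Data.Product using (Σ; _×_; _,_; proj₂; ∃₂)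
open import Data.Sum using (_⊎_; inj₁; inj₂)
open import Data.Vec using (Vec; []; _∷_; _∷ʳ_; lookup; toList; fromList; initLast; cast)
import Data.Vec.Properties as Vec
open import Function using (_∘_)
open import Function.Bundles using (_⇔_; mk⇔)
open import Relation.Binary.PropositionalEquality hiding ([_])
open import Relation.Nullary using (Dec; yes; no; contradiction)
open import Relation.Nullary.Decidable using (dec-true; dec-false; does-⇔; ⌊_⌋)
open import Relation.Nullary.Decidable.Core using (T?)

private variable A B X Y : Set

𝟙 : Bool → ℕ
𝟙 true  = 1
𝟙 false = 0

𝟙-∧ : ∀ x y → 𝟙 (x ∧ y) ≡ 𝟙 x * 𝟙 y
𝟙-∧ true  y = sym (*-identityˡ (𝟙 y))
𝟙-∧ false y = refl

∑ : List A → (A → ℕ) → ℕ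
∑ xs F = sum (map F xs)

∑-cong : ∀ xs {F G : A → ℕ} → (∀ {x} → x ∈ xs → F x ≡ G x) → ∑ xs F ≡ ∑ xs G
∑-cong []       eq = refl
∑-cong (x ∷ xs) eq = cong₂ _+_ (eq (here refl)) (∑-cong xs (eq ∘ there))

∑-ext : ∀ xs {F G : A → ℕ} → (∀ x → F x ≡ G x) → ∑ xs F ≡ ∑ xs G
∑-ext xs eq = ∑-cong xs (λ {x} _ → eq x)

∑-++ : ∀ xs ys (F : A → ℕ) → ∑ (xs ++ ys) F ≡ ∑ xs F + ∑ ys F
∑-++ xs ys F = trans (cong sum (map-++ F xs ys)) (sum-++ (map F xs) (map F ys))

∑-↭ : ∀ {xs ys} (F : A → ℕ) → xs ↭ ys → ∑ xs F ≡ ∑ ys F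
∑-↭ F p = sum-↭ (↭.map⁺ F p)

∑-zero : ∀ (xs : List A) → ∑ xs (λ _ → 0) ≡ 0
∑-zero []       = refl
∑-zero (x ∷ xs) = ∑-zero xs

∑-+ : ∀ xs (F G : A → ℕ) → ∑ xs (λ x → F x + G x) ≡ ∑ xs F + ∑ xs G
∑-+ []       F G = refl
∑-+ (x ∷ xs) F G =
  trans (cong ((F x + G x) +_) (∑-+ xs F G)) (interchange +-commutativeSemigroup (F x) (G x) (∑ xs F) (∑ xs G))

∑-*ˡ : ∀ xs c (F : A → ℕ) → ∑ xs (λ x → c * F x) ≡ c * ∑ xs F
∑-*ˡ []       c F = sym (*-zeroʳ c)
∑-*ˡ (x ∷ xs) c F = trans (cong (c * F x +_) (∑-*ˡ xs c F)) (sym (*-distribˡ-+ c (F x) _))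

length-filterᵇ : ∀ (p : A → Bool) xs → length (filterᵇ p xs) ≡ ∑ xs (𝟙 ∘ p)
length-filterᵇ p []       = refl
length-filterᵇ p (x ∷ xs) with p x
... | true  = cong suc (length-filterᵇ p xs)
... | false = length-filterᵇ p xs

∑-map : ∀ (g : A → B) xs (F : B → ℕ) → ∑ (map g xs) F ≡ ∑ xs (F ∘ g)
∑-map g []       F = refl
∑-map g (x ∷ xs) F = cong (F (g x) +_) (∑-map g xs F)

∑-comm : ∀ xs ys (F : A → B → ℕ) → ∑ xs (λ x → ∑ ys (F x)) ≡ ∑ ys (λ y → ∑ xs (λ x → F x y))
∑-comm []       ys F = sym (∑-zero ys)
∑-comm (x ∷ xs) ys F = trans (cong (∑ ys (F x) +_) (∑-comm xs ys F)) (sym (∑-+ ys (F x) _))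

∑-transpose : ∀ xs ys zs ws (F : A → B → X → Y → ℕ) →
  ∑ xs (λ x → ∑ ys (λ y → ∑ zs (λ z → ∑ ws (F x y z)))) ≡
  ∑ ys (λ y → ∑ ws (λ w → ∑ xs (λ x → ∑ zs (λ z → F x y z w))))
∑-transpose xs ys zs ws F = begin
  ∑ xs (λ x → ∑ ys (λ y → ∑ zs (λ z → ∑ ws (F x y z))))  ≡⟨ ∑-comm xs ys _ ⟩
  ∑ ys (λ y → ∑ xs (λ x → ∑ zs (λ z → ∑ ws (F x y z))))  ≡⟨ ∑-ext ys (λ y → ∑-ext xs (λ x → ∑-comm zs ws _)) ⟩
  ∑ ys (λ y → ∑ xs (λ x → ∑ ws (λ w → ∑ zs (λ z → F x y z w)))) ≡⟨ ∑-ext ys (λ y → ∑-comm xs ws _) ⟩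
  ∑ ys (λ y → ∑ ws (λ w → ∑ xs (λ x → ∑ zs (λ z → F x y z w)))) ∎
  where open ≡-Reasoning

concatMap≡cartesianProductWith : ∀ (g : A → B → X) xs ys →
  concatMap (λ x → map (g x) ys) xs ≡ cartesianProductWith g xs ys
concatMap≡cartesianProductWith g []       ys = refl
concatMap≡cartesianProductWith g (x ∷ xs) ys = cong (map (g x) ys ++_) (concatMap≡cartesianProductWith g xs ys)

∑-cartesianProductWith : ∀ (g : A → B → X) xs ys (F : X → ℕ) →
  ∑ (cartesianProductWith g xs ys) F ≡ ∑ xs (λ x → ∑ ys (λ y → F (g x y)))
∑-cartesianProductWith g []       ys F = refl
∑-cartesianProductWith g (x ∷ xs) ys F =
  trans (∑-++ (map (g x) ys) _ F) (cong₂ _+_ (∑-map (g x) ys F) (∑-cartesianProductWith g xs ys F))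

∑-upTo-suc : ∀ n (F : ℕ → ℕ) → ∑ (upTo (suc n)) F ≡ ∑ (upTo n) F + F n
∑-upTo-suc n F = begin
  ∑ (upTo (suc n)) F    ≡⟨ cong (λ xs → ∑ xs F) (upTo-∷ʳ n) ⟨
  ∑ (upTo n ++ [ n ]) F ≡⟨ ∑-++ (upTo n) [ n ] F ⟩
  ∑ (upTo n) F + (F n + 0) ≡⟨ cong (∑ (upTo n) F +_) (+-identityʳ (F n)) ⟩
  ∑ (upTo n) F + F n    ∎
  where open ≡-Reasoning

∑-upTo-sucˡ : ∀ n (F : ℕ → ℕ) → ∑ (upTo (suc n)) F ≡ F 0 + ∑ (upTo n) (F ∘ suc)
∑-upTo-sucˡ n F = cong (F 0 +_) (trans (cong (λ xs → ∑ xs F) (sym (map-upTo suc n))) (∑-map suc (upTo n) F))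

≤ᵇ-suc : ∀ a b → (suc a ≤ᵇ suc b) ≡ (a ≤ᵇ b)
≤ᵇ-suc zero    b = refl
≤ᵇ-suc (suc a) b = refl

∑-upTo-differences : ∀ n (G : ℕ → ℕ) →
  ∑ (upTo n) (λ a → ∑ (upTo n) (λ b → 𝟙 (a ≤ᵇ b) * G (b ∸ a))) ≡ ∑ (upTo n) (λ h → (n ∸ h) * G h)
∑-upTo-differences zero    G = refl
∑-upTo-differences (suc n) G = begin
  Pairs (suc n)                                     ≡⟨ ∑-upTo-sucˡ n _ ⟩
  ∑ (upTo (suc n)) (λ b → 1 * G b) + ∑ (upTo n) (λ a → ∑ (upTo (suc n)) (λ b → 𝟙 (suc a ≤ᵇ b) * G (b ∸ suc a)))
    ≡⟨ cong₂ _+_ (∑-ext (upTo (suc n)) (λ b → *-identityˡ (G b)))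
                 (∑-ext (upTo n) (λ a → trans (∑-upTo-sucˡ n (λ b → 𝟙 (suc a ≤ᵇ b) * G (b ∸ suc a)))
                    (∑-ext (upTo n) (λ b → cong (λ t → 𝟙 t * G (b ∸ a)) (≤ᵇ-suc a b))))) ⟩
  ∑ (upTo (suc n)) G + Pairs n                      ≡⟨ cong (∑ (upTo (suc n)) G +_) (∑-upTo-differences n G) ⟩
  ∑ (upTo (suc n)) G + R n                          ≡⟨ cong (∑ (upTo (suc n)) G +_) R-step ⟨
  ∑ (upTo (suc n)) G + ∑ (upTo (suc n)) (λ h → (n ∸ h) * G h)
                                                    ≡⟨ ∑-+ (upTo (suc n)) G _ ⟨
  ∑ (upTo (suc n)) (λ h → G h + (n ∸ h) * G h)
    ≡⟨ ∑-cong (upTo (suc n)) (λ {h} h∈ → cong (_* G h) (+-∸-assoc 1 (s≤s⁻¹ (∈-upTo⁻ h∈)))) ⟨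
  R (suc n)                                         ∎
  where
  open ≡-Reasoning
  Pairs R : ℕ → ℕ
  Pairs m = ∑ (upTo m) (λ a → ∑ (upTo m) (λ b → 𝟙 (a ≤ᵇ b) * G (b ∸ a)))
  R m = ∑ (upTo m) (λ h → (m ∸ h) * G h)
  R-step : ∑ (upTo (suc n)) (λ h → (n ∸ h) * G h) ≡ R n
  R-step = begin
    ∑ (upTo (suc n)) (λ h → (n ∸ h) * G h) ≡⟨ ∑-upTo-suc n _ ⟩
    R n + (n ∸ n) * G n                    ≡⟨ cong (λ t → R n + t * G n) (n∸n≡0 n) ⟩
    R n + 0                                ≡⟨ +-identityʳ (R n) ⟩
    R n                                    ∎

-- Lehmer codes and pairs of codes with a given rank gap

lookup-∷ʳ-inject₁ : ∀ {n} (c : Vec A n) a j → lookup (c ∷ʳ a) (inject₁ j) ≡ lookup c j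
lookup-∷ʳ-inject₁ (x ∷ c) a zero    = refl
lookup-∷ʳ-inject₁ (x ∷ c) a (suc j) = lookup-∷ʳ-inject₁ c a j

lookup-∷ʳ-fromℕ : ∀ {n} (c : Vec A n) a → lookup (c ∷ʳ a) (fromℕ n) ≡ a
lookup-∷ʳ-fromℕ []      a = refl
lookup-∷ʳ-fromℕ (x ∷ c) a = lookup-∷ʳ-fromℕ c a

inject₁-or-fromℕ : ∀ {n} (i : Fin (suc n)) → (Σ (Fin n) λ j → i ≡ inject₁ j) ⊎ i ≡ fromℕ n
inject₁-or-fromℕ {zero}  zero    = inj₂ refl
inject₁-or-fromℕ {suc n} zero    = inj₁ (zero , refl)
inject₁-or-fromℕ {suc n} (suc i) with inject₁-or-fromℕ i
... | inj₁ (j , refl) = inj₁ (suc j , refl)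
... | inj₂ refl       = inj₂ refl

IsCode : ∀ {n} → Vec ℕ n → Set
IsCode c = ∀ i → lookup c i ≤ toℕ i

IsCode-∷ʳ⁺ : ∀ {n} (c : Vec ℕ n) a → IsCode c → a ≤ n → IsCode (c ∷ʳ a)
IsCode-∷ʳ⁺ {n} c a code a≤n i with inject₁-or-fromℕ i
... | inj₁ (j , refl) = subst₂ _≤_ (sym (lookup-∷ʳ-inject₁ c a j)) (sym (toℕ-inject₁ j)) (code j)
... | inj₂ refl       = subst₂ _≤_ (sym (lookup-∷ʳ-fromℕ c a)) (sym (toℕ-fromℕ n)) a≤n

IsCode-∷ʳ⁻ : ∀ {n} (c : Vec ℕ n) a → IsCode (c ∷ʳ a) → IsCode c × a ≤ n
IsCode-∷ʳ⁻ {n} c a code =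
  (λ j → subst₂ _≤_ (lookup-∷ʳ-inject₁ c a j) (toℕ-inject₁ j) (code (inject₁ j))) ,
  subst₂ _≤_ (lookup-∷ʳ-fromℕ c a) (toℕ-fromℕ n) (code (fromℕ n))

Codes : (n : ℕ) → List (Vec ℕ n)
Codes zero    = [ [] ]
Codes (suc n) = cartesianProductWith _∷ʳ_ (Codes n) (upTo (suc n))

Codes-unique : ∀ n → Unique (Codes n)
Codes-unique zero    = [] ∷ []
Codes-unique (suc n) = Unique.cartesianProductWith⁺ _∷ʳ_ (Vec.∷ʳ-injective _ _) (Codes-unique n) (Unique.upTo⁺ (suc n))

∈-Codes⁺ : ∀ {n} (c : Vec ℕ n) → IsCode c → c ∈ Codes n
∈-Codes⁺ []                   _    = here refl
∈-Codes⁺ {suc n} c code with initLast c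
... | c′ , a , refl with IsCode-∷ʳ⁻ c′ a code
...   | code′ , a≤n = ∈-cartesianProductWith⁺ _∷ʳ_ (∈-Codes⁺ c′ code′) (∈-upTo⁺ (s≤s a≤n))

∈-Codes⁻ : ∀ {n} {c : Vec ℕ n} → c ∈ Codes n → IsCode c
∈-Codes⁻ {zero}  {[]} _ ()
∈-Codes⁻ {suc n} c∈ with ∈-cartesianProductWith⁻ _∷ʳ_ (Codes n) (upTo (suc n)) c∈
... | c′ , a , c′∈ , a∈ , refl = IsCode-∷ʳ⁺ c′ a (∈-Codes⁻ c′∈) (s≤s⁻¹ (∈-upTo⁻ a∈))

≤ᵛ-∷ʳ : ∀ {n} (c d : Vec ℕ n) a b → ((c ∷ʳ a) ≤ᵛ (d ∷ʳ b)) ≡ (c ≤ᵛ d) ∧ (a ≤ᵇ b)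
≤ᵛ-∷ʳ []      []      a b = ∧-identityʳ (a ≤ᵇ b)
≤ᵛ-∷ʳ (x ∷ c) (y ∷ d) a b = trans (cong ((x ≤ᵇ y) ∧_) (≤ᵛ-∷ʳ c d a b)) (sym (∧-assoc (x ≤ᵇ y) _ _))

≤ᵛ⇒sum-≤ : ∀ {n} (c d : Vec ℕ n) → T (c ≤ᵛ d) → sum (toList c) ≤ sum (toList d)
≤ᵛ⇒sum-≤ []      []      _ = z≤n
≤ᵛ⇒sum-≤ (x ∷ c) (y ∷ d) t with x ≤ᵇ y in x≤y
... | true = +-mono-≤ (≤ᵇ⇒≤ x y (subst T (sym x≤y) _)) (≤ᵛ⇒sum-≤ c d t)

sum-∷ʳ : ∀ {n} (c : Vec ℕ n) a → sum (toList (c ∷ʳ a)) ≡ sum (toList c) + a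
sum-∷ʳ c a = begin
  sum (toList (c ∷ʳ a))        ≡⟨ cong sum (Vec.toList-∷ʳ a c) ⟩
  sum (toList c ++ [ a ])      ≡⟨ sum-++ (toList c) [ a ] ⟩
  sum (toList c) + (a + 0)     ≡⟨ cong (sum (toList c) +_) (+-identityʳ a) ⟩
  sum (toList c) + a           ∎
  where open ≡-Reasoning

hasRankGap : ∀ {n} → ℤ → Vec ℕ n × Vec ℕ n → Bool
hasRankGap (ℤ.+ k)  (c , d) = (c ≤ᵛ d) ∧ (sum (toList d) ≡ᵇ sum (toList c) + k)
hasRankGap -[1+ _ ] _       = false

+m-+n≡+[m∸n] : ∀ {k h} → h ≤ k → ℤ.+ k ℤ.- ℤ.+ h ≡ ℤ.+ (k ∸ h)
+m-+n≡+[m∸n] {k} {h} h≤k = trans (m-n≡m⊖n k h) (⊖-≥ h≤k)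

hasRankGap-< : ∀ {n k h} (p : Vec ℕ n × Vec ℕ n) → k < h → hasRankGap (ℤ.+ k ℤ.- ℤ.+ h) p ≡ false
hasRankGap-< {k = k} {h} p k<h rewrite m-n≡m⊖n k h | ⊖-< k<h with h ∸ k | m<n⇒0<n∸m k<h
... | suc _ | _ = refl

+-shift-≡⇔ : ∀ {x y a b h j k} → b ≡ h + a → k ≡ j + h → (x + b ≡ y + a + k) ⇔ (x ≡ y + j)
+-shift-≡⇔ {x} {y} {a} {_} {h} {j} refl refl = mk⇔
  (λ e → +-cancelʳ-≡ (h + a) x (y + j) (trans e (rearrange y a j h)))
  (λ e → trans (cong (_+ (h + a)) e) (sym (rearrange y a j h)))
  where
  rearrange : ∀ y a j h → y + a + (j + h) ≡ y + j + (h + a)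
  rearrange = solve-∀

hasRankGap-∷ʳ : ∀ {n} k (c d : Vec ℕ n) a b →
  hasRankGap (ℤ.+ k) (c ∷ʳ a , d ∷ʳ b) ≡ (a ≤ᵇ b) ∧ hasRankGap (ℤ.+ k ℤ.- ℤ.+ (b ∸ a)) (c , d)
hasRankGap-∷ʳ k c d a b rewrite ≤ᵛ-∷ʳ c d a b | sum-∷ʳ c a | sum-∷ʳ d b with a ≤? b
... | no a≰b  rewrite dec-false (a ≤? b) a≰b | ∧-zeroʳ (c ≤ᵛ d) = refl
... | yes a≤b rewrite dec-true (a ≤? b) a≤b | ∧-identityʳ (c ≤ᵛ d) with b ∸ a ≤? k
...   | yes h≤k rewrite +m-+n≡+[m∸n] h≤k =
        cong ((c ≤ᵛ d) ∧_) (does-⇔ (+-shift-≡⇔ {sum (toList d)} {sum (toList c)} (sym (m∸n+n≡m a≤b)) (sym (m∸n+n≡m h≤k)))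
                                   (_ ≟ _) (_ ≟ _))
...   | no h≰k rewrite hasRankGap-< (c , d) (≰⇒> h≰k) with c ≤ᵛ d in c≤d
...     | false = refl
...     | true  = dec-false (_ ≟ _) (λ e → <-irrefl (sym e) (gap (≤ᵛ⇒sum-≤ c d (subst T (sym c≤d) _))))
  where
  gap : sum (toList c) ≤ sum (toList d) → sum (toList c) + a + k < sum (toList d) + b
  gap sc≤sd = begin-strict
    sum (toList c) + a + k        <⟨ +-monoʳ-< (sum (toList c) + a) (≰⇒> h≰k) ⟩
    sum (toList c) + a + (b ∸ a)  ≡⟨ +-assoc (sum (toList c)) a (b ∸ a) ⟩
    sum (toList c) + (a + (b ∸ a)) ≡⟨ cong (sum (toList c) +_) (m+[n∸m]≡n a≤b) ⟩
    sum (toList c) + b            ≤⟨ +-monoˡ-≤ b sc≤sd ⟩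
    sum (toList d) + b            ∎
    where open ≤-Reasoning

codeIntervals : (n : ℕ) → ℤ → ℕ
codeIntervals n j = ∑ (Codes n) λ c → ∑ (Codes n) λ d → 𝟙 (hasRankGap j (c , d))

codeIntervals-suc : ∀ m k → codeIntervals (suc m) (ℤ.+ k) ≡
  ∑ (upTo (suc m)) (λ h → (suc m ∸ h) * codeIntervals m (ℤ.+ k ℤ.- ℤ.+ h))
codeIntervals-suc m k = begin
  codeIntervals (suc m) (ℤ.+ k)
    ≡⟨ ∑-cartesianProductWith _∷ʳ_ Cₘ Uₘ _ ⟩
  ∑ Cₘ (λ c → ∑ Uₘ (λ a → ∑ (Codes (suc m)) (λ d′ → 𝟙 (hasRankGap (ℤ.+ k) (c ∷ʳ a , d′)))))
    ≡⟨ ∑-ext Cₘ (λ c → ∑-ext Uₘ (λ a → ∑-cartesianProductWith _∷ʳ_ Cₘ Uₘ _)) ⟩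
  ∑ Cₘ (λ c → ∑ Uₘ (λ a → ∑ Cₘ (λ d → ∑ Uₘ (λ b → 𝟙 (hasRankGap (ℤ.+ k) (c ∷ʳ a , d ∷ʳ b))))))
    ≡⟨ ∑-ext Cₘ (λ c → ∑-ext Uₘ (λ a → ∑-ext Cₘ (λ d → ∑-ext Uₘ (λ b →
         trans (cong 𝟙 (hasRankGap-∷ʳ k c d a b)) (𝟙-∧ (a ≤ᵇ b) _))))) ⟩
  ∑ Cₘ (λ c → ∑ Uₘ (λ a → ∑ Cₘ (λ d → ∑ Uₘ (λ b → 𝟙 (a ≤ᵇ b) * 𝟙 (hasRankGap (excess (b ∸ a)) (c , d))))))
    ≡⟨ ∑-transpose Cₘ Uₘ Cₘ Uₘ _ ⟩
  ∑ Uₘ (λ a → ∑ Uₘ (λ b → ∑ Cₘ (λ c → ∑ Cₘ (λ d → 𝟙 (a ≤ᵇ b) * 𝟙 (hasRankGap (excess (b ∸ a)) (c , d))))))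
    ≡⟨ ∑-ext Uₘ (λ a → ∑-ext Uₘ (λ b → trans (∑-ext Cₘ (λ c → ∑-*ˡ Cₘ (𝟙 (a ≤ᵇ b)) _)) (∑-*ˡ Cₘ (𝟙 (a ≤ᵇ b)) _))) ⟩
  ∑ Uₘ (λ a → ∑ Uₘ (λ b → 𝟙 (a ≤ᵇ b) * codeIntervals m (excess (b ∸ a))))
    ≡⟨ ∑-upTo-differences (suc m) (codeIntervals m ∘ excess) ⟩
  ∑ Uₘ (λ h → (suc m ∸ h) * codeIntervals m (excess h))
    ∎
  where
  open ≡-Reasoning
  Cₘ : List (Vec ℕ m)
  Cₘ = Codes m
  Uₘ : List ℕ
  Uₘ = upTo (suc m)
  excess : ℕ → ℤ
  excess h = ℤ.+ k ℤ.- ℤ.+ h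

unique-↭ : ∀ {xs ys : List A} → xs ↭ ys → Unique xs → Unique ys
unique-↭ p = ↭ₛ.Unique-resp-↭ (setoid _) (↭⇒↭ₛ p)

∈⇒↭-∷ : ∀ {x : A} {ys} → x ∈ ys → ∃₂ λ P S → ys ≡ P ++ x ∷ S × ys ↭ x ∷ (P ++ S)
∈⇒↭-∷ {x = x} x∈ with ∈-∃++ x∈
... | P , S , refl = P , S , refl , ↭.shift x P S

unique-⊆-length⇒↭ : ∀ {xs ys : List A} → Unique xs → Unique ys → xs ⊆ ys → length xs ≡ length ys → xs ↭ ys
unique-⊆-length⇒↭ {xs = []}     {[]}    _ _ _ _ = ↭-refl
unique-⊆-length⇒↭ {xs = x ∷ xs} {ys} (x∉xs ∷ uxs) uys xs⊆ys len
  with P , S , refl , ys↭ ← ∈⇒↭-∷ (xs⊆ys (here refl))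
  with _ ∷ uys′ ← unique-↭ ys↭ uys
  = ↭-trans (↭-prep x (unique-⊆-length⇒↭ uxs uys′ xs⊆ys′ len′)) (↭-sym ys↭)
  where
  xs⊆ys′ : xs ⊆ P ++ S
  xs⊆ys′ {z} z∈ with ↭.∈-resp-↭ ys↭ (xs⊆ys (there z∈))
  ... | here refl = contradiction z∈ (λ z∈xs → All.lookup x∉xs z∈xs refl)
  ... | there z∈′ = z∈′
  len′ : length xs ≡ length (P ++ S)
  len′ = suc-injective (trans len (↭.↭-length ys↭))

-- insertAt k a L places a so that min k (length L) entries of L follow it.
insertAt : ℕ → A → List A → List A
insertAt k a []      = [ a ]
insertAt k a (b ∷ L) = if length L <ᵇ k then a ∷ b ∷ L else b ∷ insertAt k a L

insertAt-↭ : ∀ k (a : A) L → insertAt k a L ↭ a ∷ L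
insertAt-↭ k a []      = ↭-refl
insertAt-↭ k a (b ∷ L) with length L <ᵇ k
... | true  = ↭-refl
... | false = ↭-trans (↭-prep b (insertAt-↭ k a L)) (↭-swap b a ↭-refl)

insertAt-++ : ∀ P S (a : A) → insertAt (length S) a (P ++ S) ≡ P ++ a ∷ S
insertAt-++ []      []      a = refl
insertAt-++ []      (b ∷ S) a rewrite dec-true (length S <? suc (length S)) (n<1+n (length S)) = refl
insertAt-++ (b ∷ P) S       a
  rewrite dec-false (length (P ++ S) <? length S) (≤⇒≯ (subst (length S ≤_) (sym (length-++ P)) (m≤n+m _ _))) =
  cong (b ∷_) (insertAt-++ P S a)

filterᵇ-insertAt : ∀ (p : A → Bool) k a L → p a ≡ false → filterᵇ p (insertAt k a L) ≡ filterᵇ p L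
filterᵇ-insertAt p k a []      pa rewrite pa = refl
filterᵇ-insertAt p k a (b ∷ L) pa with length L <ᵇ k
... | true  rewrite pa = refl
... | false with p b
...   | true  = cong (b ∷_) (filterᵇ-insertAt p k a L pa)
...   | false = filterᵇ-insertAt p k a L pa

length-filterᵇ-∧ : ∀ (p q : A → Bool) xs → length (filterᵇ (λ x → p x ∧ q x) xs) ≤ length (filterᵇ p xs)
length-filterᵇ-∧ p q []       = z≤n
length-filterᵇ-∧ p q (x ∷ xs) with p x | q x
... | true  | true  = s≤s (length-filterᵇ-∧ p q xs)
... | true  | false = m≤n⇒m≤1+n (length-filterᵇ-∧ p q xs)
... | false | _     = length-filterᵇ-∧ p q xs

segment : ℕ → ℕ → List ℕ
segment t zero    = []
segment t (suc m) = t ∷ segment (suc t) m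

tabulate-segment : ∀ {m} (g : Fin m → ℕ) t → (∀ i → g i ≡ t + toℕ i) → Data.List.tabulate g ≡ segment t m
tabulate-segment {zero}  g t eq = refl
tabulate-segment {suc m} g t eq =
  cong₂ _∷_ (trans (eq zero) (+-identityʳ t))
            (tabulate-segment (g ∘ suc) (suc t) (λ i → trans (eq (suc i)) (+-suc t (toℕ i))))

map-toℕ-allFin : ∀ n → map toℕ (allFin n) ≡ segment 0 n
map-toℕ-allFin n = trans (map-tabulate (λ i → i) toℕ) (tabulate-segment toℕ 0 (λ i → refl))

∑-segment-<ᵇ : ∀ s m t → ∑ (segment s m) (λ x → 𝟙 (x <ᵇ t)) ≡ (t ∸ s) ⊓ m
∑-segment-<ᵇ s zero    t       = sym (⊓-zeroʳ (t ∸ s))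
∑-segment-<ᵇ s (suc m) zero    rewrite 0∸n≡0 s = trans (∑-segment-<ᵇ (suc s) m zero) (cong (_⊓ m) (0∸n≡0 (suc s)))
∑-segment-<ᵇ s (suc m) (suc t) with s ≤? t
... | yes s≤t rewrite dec-true (s <? suc t) (s≤s s≤t) | +-∸-assoc 1 s≤t = cong suc (∑-segment-<ᵇ (suc s) m (suc t))
... | no s≰t  rewrite dec-false (s <? suc t) (s≰t ∘ s≤s⁻¹) | m≤n⇒m∸n≡0 (≰⇒> s≰t) =
  trans (∑-segment-<ᵇ (suc s) m (suc t)) (cong (_⊓ m) (m≤n⇒m∸n≡0 (<⇒≤ (≰⇒> s≰t))))

allVecs-suc : ∀ (xs : List A) m → allVecs xs (suc m) ≡ cartesianProductWith _∷_ xs (allVecs xs m)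
allVecs-suc xs m = concatMap≡cartesianProductWith _∷_ xs (allVecs xs m)

∈-allVecs : ∀ {xs : List A} m → (∀ x → x ∈ xs) → (v : Vec A m) → v ∈ allVecs xs m
∈-allVecs zero    _   []      = here refl
∈-allVecs {xs = xs} (suc m) all (x ∷ v) =
  subst (x ∷ v ∈_) (sym (allVecs-suc xs m)) (∈-cartesianProductWith⁺ _∷_ (all x) (∈-allVecs m all v))

allVecs-unique : ∀ {xs : List A} m → Unique xs → Unique (allVecs xs m)
allVecs-unique zero    _  = [] ∷ []
allVecs-unique {xs = xs} (suc m) u =
  subst Unique (sym (allVecs-suc xs m)) (Unique.cartesianProductWith⁺ _∷_ Vec.∷-injective u (allVecs-unique m u))

-- The inversion sequence as a bijection onto Lehmer codes

module InversionSequences (n : ℕ) where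

  if-≟-refl : ∀ {B : Set} (a : Fin n) (x y : B) → (if ⌊ a ≟ᶠ a ⌋ then x else y) ≡ x
  if-≟-refl a x y with a ≟ᶠ a
  ... | yes _   = refl
  ... | no a≢a = contradiction refl a≢a

  if-≟-≢ : ∀ {B : Set} {a b : Fin n} (x y : B) → a ≢ b → (if ⌊ a ≟ᶠ b ⌋ then x else y) ≡ y
  if-≟-≢ {a = a} {b} x y a≢b with a ≟ᶠ b
  ... | yes a≡b = contradiction a≡b a≢b
  ... | no _    = refl

  ≡-or-≢ : ∀ (a b : Fin n) → a ≡ b ⊎ a ≢ b
  ≡-or-≢ a b with a ≟ᶠ b
  ... | yes a≡b = inj₁ a≡b
  ... | no a≢b  = inj₂ a≢b

  after : Fin n → List (Fin n) → List (Fin n)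
  after a []       = []
  after a (b ∷ bs) = if ⌊ a ≟ᶠ b ⌋ then bs else after a bs

  after-++ : ∀ {a} P S → a ∉ P → after a (P ++ a ∷ S) ≡ S
  after-++ {a} []      S _   = if-≟-refl a S (after a S)
  after-++ {a} (b ∷ P) S a∉ =
    trans (if-≟-≢ (P ++ a ∷ S) _ (a∉ ∘ here)) (after-++ P S (a∉ ∘ there))

  below : ℕ → List (Fin n) → List (Fin n)
  below t = filterᵇ (λ j → toℕ j <ᵇ t)

  ∈-below⁻ : ∀ {j t} L → j ∈ below t L → toℕ j < t
  ∈-below⁻ {j} {t} L j∈ = <ᵇ⇒< (toℕ j) t (proj₂ (∈-filter⁻ (T? ∘ (λ j → toℕ j <ᵇ t)) {xs = L} j∈))

  below-all : ∀ {t} L → All (λ j → toℕ j < t) L → below t L ≡ L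
  below-all L L<t = filter-all (T? ∘ _) (All.map <⇒<ᵇ L<t)

  below-zero : ∀ L → below 0 L ≡ []
  below-zero []      = refl
  below-zero (j ∷ L) = below-zero L

  below-suc-∉ : ∀ {a} P → a ∉ P → below (suc (toℕ a)) P ≡ below (toℕ a) P
  below-suc-∉ []      _  = refl
  below-suc-∉ {a} (b ∷ P) a∉
    rewrite does-⇔ {A = toℕ b < suc (toℕ a)} {B = toℕ b < toℕ a}
                   (mk⇔ (λ b≤a → ≤∧≢⇒< (s≤s⁻¹ b≤a) (λ e → a∉ (here (sym (toℕ-injective e))))) m≤n⇒m≤1+n)
                   (toℕ b <? suc (toℕ a)) (toℕ b <? toℕ a)
    with toℕ b <ᵇ toℕ a
  ... | true  = cong (b ∷_) (below-suc-∉ P (a∉ ∘ there))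
  ... | false = below-suc-∉ P (a∉ ∘ there)

  length-below-allFin : ∀ {t} → t ≤ n → length (below t (allFin n)) ≡ t
  length-below-allFin {t} t≤n = begin
    length (below t (allFin n))                  ≡⟨ length-filterᵇ _ (allFin n) ⟩
    ∑ (allFin n) (λ j → 𝟙 (toℕ j <ᵇ t))          ≡⟨ ∑-map toℕ (allFin n) (λ x → 𝟙 (x <ᵇ t)) ⟨
    ∑ (map toℕ (allFin n)) (λ x → 𝟙 (x <ᵇ t))    ≡⟨ cong (λ xs → ∑ xs (λ x → 𝟙 (x <ᵇ t))) (map-toℕ-allFin n) ⟩
    ∑ (segment 0 n) (λ x → 𝟙 (x <ᵇ t))           ≡⟨ ∑-segment-<ᵇ 0 n t ⟩
    t ⊓ n                                        ≡⟨ m≤n⇒m⊓n≡m t≤n ⟩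
    t                                            ∎
    where open ≡-Reasoning

  smallerAfter : List (Fin n) → Fin n → ℕ
  smallerAfter L a = length (below (toℕ a) (after a L))

  inverted : List (Fin n) → Fin n → Fin n → Bool
  inverted L i j = (toℕ j <ᵇ toℕ i) ∧ (posOf i L <ᵇ posOf j L)

  ∑-inverted : ∀ L i → Unique L → ∑ L (𝟙 ∘ inverted L i) ≡ smallerAfter L i
  ∑-inverted []      i _ = refl
  ∑-inverted (b ∷ L) i (b∉L ∷ uL) with ≡-or-≢ i b
  ... | inj₁ refl = begin
    𝟙 (inverted (i ∷ L) i i) + ∑ L (𝟙 ∘ inverted (i ∷ L) i)
      ≡⟨ cong₂ _+_ (cong (λ p → 𝟙 ((toℕ i <ᵇ toℕ i) ∧ (p <ᵇ p))) (if-≟-refl i 0 _))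
                   (∑-cong L (λ j∈ → cong 𝟙 (later j∈))) ⟩
    𝟙 ((toℕ i <ᵇ toℕ i) ∧ false) + ∑ L (λ j → 𝟙 (toℕ j <ᵇ toℕ i))
      ≡⟨ cong (λ x → 𝟙 x + ∑ L (λ j → 𝟙 (toℕ j <ᵇ toℕ i))) (∧-zeroʳ _) ⟩
    ∑ L (λ j → 𝟙 (toℕ j <ᵇ toℕ i))
      ≡⟨ length-filterᵇ _ L ⟨
    length (below (toℕ i) L)
      ≡⟨ cong (length ∘ below (toℕ i)) (if-≟-refl i L _) ⟨
    smallerAfter (i ∷ L) i ∎
    where
    open ≡-Reasoning
    later : ∀ {j} → j ∈ L → inverted (i ∷ L) i j ≡ (toℕ j <ᵇ toℕ i)
    later {j} j∈ rewrite if-≟-refl i 0 (suc (posOf i L))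
                       | if-≟-≢ 0 (suc (posOf j L)) (λ j≡i → All.lookup b∉L j∈ (sym j≡i)) = ∧-identityʳ _
  ... | inj₂ i≢b = begin
    𝟙 (inverted (b ∷ L) i b) + ∑ L (𝟙 ∘ inverted (b ∷ L) i)
      ≡⟨ cong₂ _+_ (cong (λ p → 𝟙 ((toℕ b <ᵇ toℕ i) ∧ (posOf i (b ∷ L) <ᵇ p))) (if-≟-refl b 0 _))
                   (∑-cong L (λ j∈ → cong 𝟙 (shifted j∈))) ⟩
    𝟙 ((toℕ b <ᵇ toℕ i) ∧ false) + ∑ L (𝟙 ∘ inverted L i)
      ≡⟨ cong₂ (λ x y → 𝟙 x + y) (∧-zeroʳ _) (∑-inverted L i uL) ⟩
    smallerAfter L i
      ≡⟨ cong (length ∘ below (toℕ i)) (if-≟-≢ L (after i L) i≢b) ⟨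
    smallerAfter (b ∷ L) i ∎
    where
    open ≡-Reasoning
    shifted : ∀ {j} → j ∈ L → inverted (b ∷ L) i j ≡ inverted L i j
    shifted {j} j∈ rewrite if-≟-≢ 0 (suc (posOf i L)) i≢b
                         | if-≟-≢ 0 (suc (posOf j L)) (λ j≡b → All.lookup b∉L j∈ (sym j≡b)) = refl

  below-self : ∀ a S → below (toℕ a) (a ∷ S) ≡ below (toℕ a) S
  below-self a S rewrite dec-false (toℕ a <? toℕ a) (<-irrefl refl) = refl

  below-suc-self : ∀ a S → below (suc (toℕ a)) (a ∷ S) ≡ a ∷ below (suc (toℕ a)) S
  below-suc-self a S rewrite dec-true (toℕ a <? suc (toℕ a)) ≤-refl = refl

  insertAt-below : ∀ L {a} → Unique L → a ∈ L →
                   insertAt (smallerAfter L a) a (below (toℕ a) L) ≡ below (suc (toℕ a)) L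
  insertAt-below L {a} uL a∈L with P , S , refl , L↭ ← ∈⇒↭-∷ a∈L = begin
    insertAt (smallerAfter (P ++ a ∷ S) a) a (below t (P ++ a ∷ S))
      ≡⟨ cong₂ (λ k L′ → insertAt k a L′) (cong (length ∘ below t) (after-++ P S a∉P))
               (trans (filter-++ (T? ∘ _) P (a ∷ S)) (cong (below t P ++_) (below-self a S))) ⟩
    insertAt (length (below t S)) a (below t P ++ below t S)
      ≡⟨ insertAt-++ (below t P) (below t S) a ⟩
    below t P ++ a ∷ below t S
      ≡⟨ cong₂ (λ P′ S′ → P′ ++ a ∷ S′) (below-suc-∉ P a∉P) (below-suc-∉ S a∉S) ⟨
    below (suc t) P ++ a ∷ below (suc t) S
      ≡⟨ trans (filter-++ (T? ∘ _) P (a ∷ S)) (cong (below (suc t) P ++_) (below-suc-self a S)) ⟨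
    below (suc t) (P ++ a ∷ S) ∎
    where
    open ≡-Reasoning
    t : ℕ
    t = toℕ a
    a∉P++S : a ∉ P ++ S
    a∉P++S = Unique.Unique[x∷xs]⇒x∉xs (unique-↭ L↭ uL)
    a∉P : a ∉ P
    a∉P = a∉P++S ∘ ∈-++⁺ˡ
    a∉S : a ∉ S
    a∉S = a∉P++S ∘ ∈-++⁺ʳ P

  below-suc-↭ : ∀ L {a} → Unique L → a ∈ L → below (suc (toℕ a)) L ↭ a ∷ below (toℕ a) L
  below-suc-↭ L {a} uL a∈L =
    subst (_↭ a ∷ below (toℕ a) L) (insertAt-below L uL a∈L) (insertAt-↭ (smallerAfter L a) a (below (toℕ a) L))

  smallerAfter-insertAt : ∀ {a k} L → a ∉ L → All (λ j → toℕ j < toℕ a) L → k ≤ length L →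
                          smallerAfter (insertAt k a L) a ≡ k
  smallerAfter-insertAt {a} {k} L a∉L L<a k≤∣L∣ = begin
    smallerAfter (insertAt k a L) a
      ≡⟨ cong₂ (λ k′ L′ → smallerAfter (insertAt k′ a L′) a) ∣S∣≡k (take++drop≡id r L) ⟨
    smallerAfter (insertAt (length S) a (P ++ S)) a
      ≡⟨ cong (λ L′ → smallerAfter L′ a) (insertAt-++ P S a) ⟩
    length (below (toℕ a) (after a (P ++ a ∷ S)))
      ≡⟨ cong (length ∘ below (toℕ a)) (after-++ P S a∉P) ⟩
    length (below (toℕ a) S)
      ≡⟨ cong length (below-all S S<a) ⟩
    length S
      ≡⟨ ∣S∣≡k ⟩
    k ∎
    where
    open ≡-Reasoning
    r : ℕ
    r = length L ∸ k
    P S : List (Fin n)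
    P = take r L
    S = drop r L
    ∣S∣≡k : length S ≡ k
    ∣S∣≡k = trans (length-drop r L) (m∸[m∸n]≡n k≤∣L∣)
    a∉P : a ∉ P
    a∉P a∈P = a∉L (subst (a ∈_) (take++drop≡id r L) (∈-++⁺ˡ a∈P))
    S<a : All (λ j → toℕ j < toℕ a) S
    S<a = All.++⁻ʳ P (subst (All _) (sym (take++drop≡id r L)) L<a)

  smallerAfter-insertAt-< : ∀ {t a} k L → toℕ t < toℕ a → smallerAfter (insertAt k a L) t ≡ smallerAfter L t
  smallerAfter-insertAt-< {t} {a} k [] t<a = cong (length ∘ below (toℕ t)) (if-≟-≢ [] [] t≢a)
    where t≢a : t ≢ a
          t≢a t≡a = <-irrefl (cong toℕ t≡a) t<a
  smallerAfter-insertAt-< {t} {a} k (b ∷ L) t<a with length L <ᵇ k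
  ... | true  = cong (length ∘ below (toℕ t)) (if-≟-≢ (b ∷ L) _ (λ t≡a → <-irrefl (cong toℕ t≡a) t<a))
  ... | false with ≡-or-≢ t b
  ...   | inj₁ refl = begin
    length (below (toℕ t) (after t (t ∷ insertAt k a L)))  ≡⟨ cong (length ∘ below (toℕ t)) (if-≟-refl t _ _) ⟩
    length (below (toℕ t) (insertAt k a L))                ≡⟨ cong length (filterᵇ-insertAt _ k a L a≮t) ⟩
    length (below (toℕ t) L)                               ≡⟨ cong (length ∘ below (toℕ t)) (if-≟-refl t L _) ⟨
    smallerAfter (t ∷ L) t                                 ∎
    where open ≡-Reasoning
          a≮t : (toℕ a <ᵇ toℕ t) ≡ false
          a≮t = dec-false (toℕ a <? toℕ t) (<⇒≯ t<a)
  ...   | inj₂ t≢b = begin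
    smallerAfter (b ∷ insertAt k a L) t  ≡⟨ cong (length ∘ below (toℕ t)) (if-≟-≢ _ _ t≢b) ⟩
    smallerAfter (insertAt k a L) t      ≡⟨ smallerAfter-insertAt-< k L t<a ⟩
    smallerAfter L t                     ≡⟨ cong (length ∘ below (toℕ t)) (if-≟-≢ L _ t≢b) ⟨
    smallerAfter (b ∷ L) t               ∎
    where open ≡-Reasoning

  ↭-allFin⇒unique : ∀ {L} → L ↭ allFin n → Unique L
  ↭-allFin⇒unique p = unique-↭ (↭-sym p) (Unique.allFin⁺ n)

  ↭-allFin⇒∈ : ∀ {L} → L ↭ allFin n → ∀ a → a ∈ L
  ↭-allFin⇒∈ p a = ↭.∈-resp-↭ (↭-sym p) (∈-allFin a)

  segment-≤ : ∀ (as : List (Fin n)) t m → map toℕ as ≡ segment t m → All (λ a → t ≤ toℕ a) as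
  segment-≤ []       t m       _ = []
  segment-≤ (a ∷ as) t (suc m) e with refl , e′ ← ∷-injective e =
    ≤-refl ∷ All.map <⇒≤ (segment-≤ as (suc t) m e′)

  decode : (Fin n → ℕ) → List (Fin n) → List (Fin n) → List (Fin n)
  decode κ []       acc = acc
  decode κ (a ∷ as) acc = decode κ as (insertAt (κ a) a acc)

  insertAt-↭-below : ∀ k a {acc} → acc ↭ below (toℕ a) (allFin n) → insertAt k a acc ↭ below (suc (toℕ a)) (allFin n)
  insertAt-↭-below k a {acc} p = ↭-trans (insertAt-↭ k a acc)
    (↭-trans (↭-prep a p) (↭-sym (below-suc-↭ (allFin n) (Unique.allFin⁺ n) (∈-allFin a))))

  decode-↭ : ∀ κ as {t m acc} → map toℕ as ≡ segment t m → acc ↭ below t (allFin n) →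
             decode κ as acc ↭ below (t + m) (allFin n)
  decode-↭ κ []       {t} {zero} {acc} _ p = subst (λ u → acc ↭ below u (allFin n)) (sym (+-identityʳ t)) p
  decode-↭ κ (a ∷ as) {t} {suc m} {acc} e p with refl , e′ ← ∷-injective e =
    subst (λ u → decode κ as (insertAt (κ a) a acc) ↭ below u (allFin n)) (sym (+-suc t m))
          (decode-↭ κ as e′ (insertAt-↭-below (κ a) a p))

  decode-smallerAfter-< : ∀ κ as {a} acc → All (λ b → toℕ a < toℕ b) as →
                          smallerAfter (decode κ as acc) a ≡ smallerAfter acc a
  decode-smallerAfter-< κ []       acc []            = refl
  decode-smallerAfter-< κ (b ∷ as) acc (a<b ∷ a<as) =
    trans (decode-smallerAfter-< κ as _ a<as) (smallerAfter-insertAt-< (κ b) acc a<b)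

  decode-smallerAfter : ∀ κ as {t m acc} → map toℕ as ≡ segment t m → acc ↭ below t (allFin n) →
                        All (λ a → κ a ≤ toℕ a) as → All (λ a → smallerAfter (decode κ as acc) a ≡ κ a) as
  decode-smallerAfter κ []       _ _ _ = []
  decode-smallerAfter κ (a ∷ as) {t} {suc m} {acc} e p (κa≤a ∷ κ≤) with refl , e′ ← ∷-injective e =
    trans (decode-smallerAfter-< κ as _ (segment-≤ as _ m e′)) (smallerAfter-insertAt acc a∉acc acc<a κa≤∣acc∣)
    ∷ decode-smallerAfter κ as e′ (insertAt-↭-below (κ a) a p) κ≤
    where
    acc<a : All (λ j → toℕ j < toℕ a) acc
    acc<a = All.tabulate (λ j∈ → ∈-below⁻ (allFin n) (↭.∈-resp-↭ p j∈))
    a∉acc : a ∉ acc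
    a∉acc a∈ = <-irrefl refl (All.lookup acc<a a∈)
    κa≤∣acc∣ : κ a ≤ length acc
    κa≤∣acc∣ = subst (κ a ≤_) (sym (trans (↭.↭-length p) (length-below-allFin (<⇒≤ (toℕ<n a))))) κa≤a

  decode-below : ∀ κ {L} → L ↭ allFin n → (∀ a → κ a ≡ smallerAfter L a) →
                 ∀ as {t m} → map toℕ as ≡ segment t m → t + m ≡ n → decode κ as (below t L) ≡ L
  decode-below κ {L} _ _ [] {t} {zero} _ t+0≡n =
    below-all L (All.tabulate (λ {j} _ → subst (toℕ j <_) (trans (sym t+0≡n) (+-identityʳ t)) (toℕ<n j)))
  decode-below κ {L} perm κ≡ (a ∷ as) {t} {suc m} e t+m≡n with refl , e′ ← ∷-injective e =
    trans (cong (decode κ as) (trans (cong (λ k → insertAt k a (below t L)) (κ≡ a))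
                                     (insertAt-below L (↭-allFin⇒unique perm) (↭-allFin⇒∈ perm a))))
          (decode-below κ perm κ≡ as e′ (trans (sym (+-suc t m)) t+m≡n))

  below-allFin : below n (allFin n) ≡ allFin n
  below-allFin = below-all (allFin n) (All.tabulate (λ {j} _ → toℕ<n j))

  []↭below-zero : [] ↭ below 0 (allFin n)
  []↭below-zero = subst ([] ↭_) (sym (below-zero (allFin n))) ↭-refl

  decodeCode : Vec ℕ n → List (Fin n)
  decodeCode c = decode (lookup c) (allFin n) []

  decodeCode-↭ : ∀ c → decodeCode c ↭ allFin n
  decodeCode-↭ c = subst (decodeCode c ↭_) below-allFin
    (decode-↭ (lookup c) (allFin n) (map-toℕ-allFin n) []↭below-zero)

  fromCode : Vec ℕ n → Vec (Fin n) n
  fromCode c = cast (trans (↭.↭-length (decodeCode-↭ c)) (length-tabulate (λ i → i))) (fromList (decodeCode c))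

  toList-fromCode : ∀ c → toList (fromCode c) ≡ decodeCode c
  toList-fromCode c = trans (Vec.toList-cast _ (fromList (decodeCode c))) (Vec.toList∘fromList (decodeCode c))

  inversionsAt : List (Fin n) → Fin n → ℕ
  inversionsAt L i = length (filterᵇ (inverted L i) (allFin n))

  lookup-invSeq : ∀ w i → lookup (invSeq w) i ≡ inversionsAt (toList w) i
  lookup-invSeq w = Vec.lookup∘tabulate (inversionsAt (toList w))

  inversionsAt-↭ : ∀ {L} → L ↭ allFin n → ∀ i → inversionsAt L i ≡ smallerAfter L i
  inversionsAt-↭ {L} p i = begin
    inversionsAt L i               ≡⟨ length-filterᵇ (inverted L i) (allFin n) ⟩
    ∑ (allFin n) (𝟙 ∘ inverted L i) ≡⟨ ∑-↭ _ (↭-sym p) ⟩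
    ∑ L (𝟙 ∘ inverted L i)          ≡⟨ ∑-inverted L i (↭-allFin⇒unique p) ⟩
    smallerAfter L i               ∎
    where open ≡-Reasoning

  IsCode-invSeq : ∀ w → IsCode (invSeq w)
  IsCode-invSeq w i = begin
    lookup (invSeq w) i                      ≡⟨ lookup-invSeq w i ⟩
    inversionsAt (toList w) i                ≤⟨ length-filterᵇ-∧ (λ j → toℕ j <ᵇ toℕ i) _ (allFin n) ⟩
    length (below (toℕ i) (allFin n))        ≡⟨ length-below-allFin (<⇒≤ (toℕ<n i)) ⟩
    toℕ i                                    ∎
    where open ≤-Reasoning

  invSeq-fromCode : ∀ c → IsCode c → invSeq (fromCode c) ≡ c
  invSeq-fromCode c code = trans (Vec.tabulate-cong entry) (Vec.tabulate∘lookup c)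
    where
    decoded : All (λ a → smallerAfter (decodeCode c) a ≡ lookup c a) (allFin n)
    decoded = decode-smallerAfter (lookup c) (allFin n) (map-toℕ-allFin n) []↭below-zero (All.tabulate (λ {i} _ → code i))
    entry : ∀ i → inversionsAt (toList (fromCode c)) i ≡ lookup c i
    entry i rewrite toList-fromCode c = trans (inversionsAt-↭ (decodeCode-↭ c) i) (All.lookup decoded (∈-allFin i))

  fromCode-invSeq : ∀ w → toList w ↭ allFin n → fromCode (invSeq w) ≡ w
  fromCode-invSeq w perm =
    trans (sym (Vec.cast-is-id refl _)) (Vec.toList-injective refl _ w (trans (toList-fromCode (invSeq w)) decoded))
    where
    decoded : decodeCode (invSeq w) ≡ toList w
    decoded = subst (λ acc → decode (lookup (invSeq w)) (allFin n) acc ≡ toList w) (below-zero (toList w))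
      (decode-below (lookup (invSeq w)) perm (λ a → trans (lookup-invSeq w a) (inversionsAt-↭ perm a))
                    (allFin n) (map-toℕ-allFin n) refl)

  unique-toList? : (w : Vec (Fin n) n) → Dec (Unique (toList w))
  unique-toList? w = UniqueDec.unique? (_≟ᶠ_ {n}) (toList w)

  ∈-Sym⁺ : ∀ w → Unique (toList w) → w ∈ Sym n
  ∈-Sym⁺ w u = ∈-filter⁺ unique-toList? (∈-allVecs n ∈-allFin w) u

  ∈-Sym⁻ : ∀ {w} → w ∈ Sym n → Unique (toList w)
  ∈-Sym⁻ w∈ = proj₂ (∈-filter⁻ unique-toList? {xs = allVecs (allFin n) n} w∈)

  Sym-unique : Unique (Sym n)
  Sym-unique = Unique.filter⁺ unique-toList? (allVecs-unique n (Unique.allFin⁺ n))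

  ∈-Sym⇒↭ : ∀ {w} → w ∈ Sym n → toList w ↭ allFin n
  ∈-Sym⇒↭ {w} w∈ = unique-⊆-length⇒↭ (∈-Sym⁻ w∈) (Unique.allFin⁺ n) (λ {a} _ → ∈-allFin a)
                                      (trans (Vec.length-toList w) (sym (length-tabulate (λ i → i))))

  map-invSeq-Sym↭Codes : map invSeq (Sym n) ↭ Codes n
  map-invSeq-Sym↭Codes = ∼bag⇒↭ (unique∧set⇒bag unique (Codes-unique n) (mk⇔ ⊆Codes ⊇Codes))
    where
    roundTrip : map fromCode (map invSeq (Sym n)) ≡ Sym n
    roundTrip = trans (sym (map-∘ (Sym n))) (map-id-local (All.tabulate (λ w∈ → fromCode-invSeq _ (∈-Sym⇒↭ w∈))))
    unique : Unique (map invSeq (Sym n))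
    unique = Unique.map⁻ (subst Unique (sym roundTrip) Sym-unique)
    ⊆Codes : ∀ {c} → c ∈ map invSeq (Sym n) → c ∈ Codes n
    ⊆Codes c∈ with w , _ , refl ← ∈-map⁻ invSeq c∈ = ∈-Codes⁺ (invSeq w) (IsCode-invSeq w)
    ⊇Codes : ∀ {c} → c ∈ Codes n → c ∈ map invSeq (Sym n)
    ⊇Codes {c} c∈ = subst (_∈ map invSeq (Sym n)) (invSeq-fromCode c (∈-Codes⁻ c∈))
      (∈-map⁺ invSeq (∈-Sym⁺ (fromCode c) (subst Unique (sym (toList-fromCode c)) (↭-allFin⇒unique (decodeCode-↭ c)))))

f≡codeIntervals : ∀ n k → f n k ≡ codeIntervals n (ℤ.+ k)
f≡codeIntervals n k = begin
  f n k
    ≡⟨ length-filterᵇ (isIntervalOfRank k) (concatMap (λ v → map (v ,_) (Sym n)) (Sym n)) ⟩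
  ∑ (concatMap (λ v → map (v ,_) (Sym n)) (Sym n)) (𝟙 ∘ isIntervalOfRank k)
    ≡⟨ cong (λ ps → ∑ ps (𝟙 ∘ isIntervalOfRank k)) (concatMap≡cartesianProductWith _,_ (Sym n) (Sym n)) ⟩
  ∑ (cartesianProductWith _,_ (Sym n) (Sym n)) (𝟙 ∘ isIntervalOfRank k)
    ≡⟨ ∑-cartesianProductWith _,_ (Sym n) (Sym n) _ ⟩
  ∑ (Sym n) (λ v → ∑ (Sym n) (λ w → 𝟙 (hasRankGap (ℤ.+ k) (invSeq v , invSeq w))))
    ≡⟨ trans (∑-map invSeq (Sym n) _) (∑-ext (Sym n) (λ v → ∑-map invSeq (Sym n) _)) ⟨
  ∑ (map invSeq (Sym n)) (λ c → ∑ (map invSeq (Sym n)) (λ d → 𝟙 (hasRankGap (ℤ.+ k) (c , d))))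
    ≡⟨ trans (∑-↭ _ Sym↭Codes) (∑-ext (Codes n) (λ c → ∑-↭ _ Sym↭Codes)) ⟩
  codeIntervals n (ℤ.+ k) ∎
  where
  open ≡-Reasoning
  Sym↭Codes : map invSeq (Sym n) ↭ Codes n
  Sym↭Codes = InversionSequences.map-invSeq-Sym↭Codes n

fℤ≡codeIntervals : ∀ n j → fℤ n j ≡ codeIntervals n j
fℤ≡codeIntervals n (ℤ.+ k)    = f≡codeIntervals n k
fℤ≡codeIntervals n -[1+ _ ] = sym (trans (∑-ext (Codes n) (λ _ → ∑-zero (Codes n))) (∑-zero (Codes n)))

-- Opened only here: the constructor +_ of ℤ would make the sections (x +_) above ambiguous.
open import Data.Integer using (+_; _-_)

theorem3p4 : (f 1 0 ≡ 1)
    × ((n k : ℕ) → 2 ≤ n → k ≤ n C 2 →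
        f n k ≡ sum (map (λ h → (n ∸ h) * fℤ (n ∸ 1) (+ k - + h)) (upTo n)))
theorem3p4 = refl , recursion
  where
  -- The recursion holds for every n ≥ 1 and every k.
  recursion : (n k : ℕ) → 2 ≤ n → k ≤ n C 2 →
              f n k ≡ sum (map (λ h → (n ∸ h) * fℤ (n ∸ 1) (+ k - + h)) (upTo n))
  recursion (suc m) k _ _ = begin
    f (suc m) k                                                  ≡⟨ f≡codeIntervals (suc m) k ⟩
    codeIntervals (suc m) (+ k)                                  ≡⟨ codeIntervals-suc m k ⟩
    ∑ (upTo (suc m)) (λ h → (suc m ∸ h) * codeIntervals m (+ k - + h))
      ≡⟨ ∑-ext (upTo (suc m)) (λ h → cong ((suc m ∸ h) *_) (fℤ≡codeIntervals m (+ k - + h))) ⟨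
    ∑ (upTo (suc m)) (λ h → (suc m ∸ h) * fℤ m (+ k - + h))      ∎
    where open ≡-Reasoning
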